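{- Let $a,b\in V(C)$ with $\mathrm{dist}_C(a,b)\in\{2,3\}$ and let $S$ be the set of internal vertices of the shortest $(a,b)$-path of $C$. Then there is no edge of $G$ between $Z_a\setminus Z_S$ and $Z_b\setminus Z_S$.
   Context: Graphs are finite and simple. A hole is an induced cycle of length at least $4$; a graph is chordal if it has no hole. Let $s_k=4k(\log k+\log\log k+4)$ for $k\ge2$, $s_1=2$, and $\mu_k=76s_{k+1}+3217k+1985$. Standing assumptions: $G$ is a graph, $k$ a positive integer, $C$ a shortest hole of $G$ of length strictly greater than $\mu_k$, and $G-V(C)$ is chordal. $D$ is the set of vertices of $G$ adjacent to every vertex of $C$; for $v\in V(C)$, $Z_v=\{v\}\cup(N(v)\setminus V(C)\setminus D)$, and for $S\subseteq V(C)$, $Z_S=\bigcup_{v\in S}Z_v$. $\mathrm{dist}_C$ denotes distance in $C$. -}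

module Defs where

open import Data.Nat as ℕ using (ℕ; zero; suc; _≤_; ∣_-_∣; _⊔_; _⊓_; _%_; _∸_)
open import Data.Nat.Base using (NonZero)
open import Data.Fin using (Fin; toℕ)
open import Data.Integer as ℤ using (ℤ; +_)
open import Data.Rational as ℚ using (ℚ; 0ℚ; 1ℚ)
open import Data.Product using (Σ; ∃; _×_; _,_)
open import Data.Sum using (_⊎_)
open import Data.Empty using (⊥)
open import Relation.Nullary using (¬_)
open import Relation.Binary.PropositionalEquality using (_≡_; _≢_)

record Graph : Set₁ where
  field
    n       : ℕ
    Adj     : Fin n → Fin n → Set
    symAdj  : ∀ {x y} → Adj x y → Adj y x
    irrefl  : ∀ {x} → ¬ Adj x x

module _ (G : Graph) where
  open Graph G

  cdist : ℕ → ℕ → ℕ → ℕ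
  cdist L i j = ∣ i - j ∣ ⊓ (L ∸ ∣ i - j ∣)

  -- c : Fin L → V(G) lists the vertices of an induced cycle of length L ≥ 4
  -- (a hole), in cyclic order.
  IsHole : (L : ℕ) → (Fin L → Fin n) → Set
  IsHole L c =
    (4 ≤ L) ×
    (∀ i j → c i ≡ c j → i ≡ j) ×
    (∀ i j → (Adj (c i) (c j) → cdist L (toℕ i) (toℕ j) ≡ 1)
           × (cdist L (toℕ i) (toℕ j) ≡ 1 → Adj (c i) (c j)))

  IsShortestHole : (L : ℕ) → (Fin L → Fin n) → Set
  IsShortestHole L c =
    IsHole L c × (∀ L' (c' : Fin L' → Fin n) → IsHole L' c' → L ≤ L')

  module Cyc {L : ℕ} (c : Fin L → Fin n) where

    InC : Fin n → Set
    InC x = ∃ λ i → c i ≡ x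

    -- G - V(C) is chordal: no hole of G avoids V(C)
    -- (a hole of G - V(C) is exactly a hole of G disjoint from V(C))
    MinusChordal : Set
    MinusChordal = ∀ L' (c' : Fin L' → Fin n) → IsHole L' c' →
                   ¬ (∀ i → ¬ InC (c' i))

    distC : Fin L → Fin L → ℕ
    distC i j = cdist L (toℕ i) (toℕ j)

    InD : Fin n → Set
    InD x = ∀ i → Adj x (c i)

    Z : Fin n → Fin n → Set
    Z v x = (x ≡ v) ⊎ (Adj v x × ¬ InC x × ¬ InD x)

    Internal : Fin L → Fin L → Fin n → Set
    Internal i j x = ∃ λ t → (c t ≡ x) × (t ≢ i) × (t ≢ j) ×
                      (distC i t ℕ.+ distC t j ≡ distC i j)

    ZS : Fin L → Fin L → Fin n → Set
    ZS i j x = ∃ λ s → Internal i j s × Z s x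

-- Real-number threshold μ_k, with natural logarithm.
-- s_m = 4m(ln m + ln ln m + 4) (m ≥ 2), μ_k = 76 s_{k+1} + 3217k + 1985.

ℕ→ℚ : ℕ → ℚ
ℕ→ℚ m = + m ℚ./ 1

expTerm : ℚ → ℕ → ℚ
expTerm x zero    = 1ℚ
expTerm x (suc i) = expTerm x i ℚ.* x ℚ.* (+ 1 ℚ./ suc i)

expPartial : ℚ → ℕ → ℚ
expPartial x zero    = 0ℚ
expPartial x (suc N) = expPartial x N ℚ.+ expTerm x N

-- For x ≥ 0 : exp x > y  (partial sums increase to exp x)
ExpGt : ℚ → ℚ → Set
ExpGt x y = ∃ λ N → y ℚ.< expPartial x N

-- With m = k+1 and B = (L - 3217k - 1985 - 1216m)/(304m),
-- μ_k < L  ⟺  B > ln(m ln m)  ⟺  B > 0 and exp(exp B / m) > m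
--          ⟺  B > 0 and ∃ rational r ≥ 0 with exp B > r m and exp r > m.
MuLt : ℕ → ℕ → Set
MuLt k L =
  let m = suc k
      B = (+ L ℤ.- + (3217 ℕ.* k ℕ.+ 1985 ℕ.+ 1216 ℕ.* m)) ℚ./ (304 ℕ.* m)
  in (0ℚ ℚ.< B) × (∃ λ r → (0ℚ ℚ.≤ r) × ExpGt B (r ℚ.* ℕ→ℚ m) × ExpGt r (ℕ→ℚ m))

{-# OPTIONS --safe #-}
-- C is a shortest hole of length greater than μ_k ≥ 7, so G has no hole of length at most 6. The shortest
-- (a,b)-path P of C is an induced path of length d ∈ {2,3}. A vertex of Z_a ∖ Z_S other than a
-- lies off P and has no neighbour on P except a and possibly b, and symmetrically for Z_b ∖ Z_S.
-- An edge xy would therefore close P into a hole of length d + 2 (through one of x, y, if it is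
-- an end of P or sees both ends) or d + 3 (through both), which is at most 6.
module Submission where

open import Defs
open import Data.Nat using (ℕ; _≤_; _+_)
open import Data.Fin using (Fin)
open import Data.Sum using (_⊎_)
open import Data.Product using (_×_)
open import Relation.Nullary using (¬_)
open import Relation.Binary.PropositionalEquality using (_≡_)

open import Data.Empty using (⊥; ⊥-elim)
open import Data.Fin.Base using (zero; suc; toℕ; fromℕ; opposite)
open import Data.Fin.Properties
  using (toℕ-injective; toℕ<n; toℕ≤pred[n]; toℕ-fromℕ; toℕ-fromℕ<; opposite-prop; opposite-involutive;
         nonZeroIndex)
import Data.Integer.Base as ℤ
import Data.Integer.Properties as ℤ
open import Data.Nat.Base using (zero; suc; _*_; _∸_; _<_; ∣_-_∣; _⊓_; _%_; NonZero; s≤s; s≤s⁻¹; z≤n)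
open import Data.Nat.DivMod
  using (_mod_; %-distribˡ-+; m%n%n≡m%n; m%n<n; m<n⇒m%n≡m; m≤n⇒[n∸m]%m≡n%m; [m+n]%n≡m%n)
open import Data.Nat.Properties
open import Data.Product.Base using (_,_)
import Data.Rational.Base as ℚ
import Data.Rational.Properties as ℚ
open import Data.Sum.Base using (inj₁; inj₂; swap; map; [_,_]′)
open import Data.Vec.Functional using (_∷_)
open import Function.Base using (id)
open import Function.Bundles using (_⇔_; mk⇔; Equivalence)
open import Function.Properties.Equivalence using () renaming (sym to ⇔-sym; trans to ⇔-trans)
open import Relation.Binary.PropositionalEquality using (_≢_; refl; sym; trans; cong; cong₂; subst; module ≡-Reasoning)
open import Relation.Nullary.Decidable.Core using (yes; no; _⊎-dec_; ¬¬-excluded-middle)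

-- Distances on a cycle

-- This is cdist G of Defs, which does not depend on G.
cyclicDist : ℕ → ℕ → ℕ → ℕ
cyclicDist L a b = ∣ a - b ∣ ⊓ (L ∸ ∣ a - b ∣)

cyclicDist-comm : ∀ L a b → cyclicDist L a b ≡ cyclicDist L b a
cyclicDist-comm L a b rewrite ∣-∣-comm a b = refl

cyclicDist-self : ∀ L a → cyclicDist L a a ≡ 0
cyclicDist-self L a rewrite ∣n-n∣≡0 a = refl

cyclicDist-half : ∀ {L a b} → a < L → b < L → cyclicDist L a b + cyclicDist L a b ≤ L
cyclicDist-half {L} {a} {b} a<L b<L = begin
  cyclicDist L a b + cyclicDist L a b ≤⟨ +-mono-≤ (m⊓n≤m e (L ∸ e)) (m⊓n≤n e (L ∸ e)) ⟩
  e + (L ∸ e)                         ≡⟨ m+[n∸m]≡n e≤L ⟩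
  L                                   ∎
  where
  open ≤-Reasoning
  e = ∣ a - b ∣
  e≤L : e ≤ L
  e≤L = ≤-trans (∣m-n∣≤m⊔n a b) (⊔-lub (<⇒≤ a<L) (<⇒≤ b<L))

cyclicDist≡1⇔ : ∀ {L} a b → 2 ≤ L → ∣ a - b ∣ ≤ L →
                cyclicDist L a b ≡ 1 ⇔ (∣ a - b ∣ ≡ 1 ⊎ suc ∣ a - b ∣ ≡ L)
cyclicDist≡1⇔ {L} a b 2≤L e≤L = mk⇔ to from
  where
  e = ∣ a - b ∣
  to : e ⊓ (L ∸ e) ≡ 1 → e ≡ 1 ⊎ suc e ≡ L
  to ⊓≡1 with ⊓-sel e (L ∸ e)
  ... | inj₁ ⊓≡e   = inj₁ (trans (sym ⊓≡e) ⊓≡1)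
  ... | inj₂ ⊓≡L∸e = inj₂ (trans (cong (_+ e) (trans (sym ⊓≡1) ⊓≡L∸e)) (m∸n+n≡m e≤L))
  from : e ≡ 1 ⊎ suc e ≡ L → e ⊓ (L ∸ e) ≡ 1
  from (inj₁ e≡1) rewrite e≡1 = m≤n⇒m⊓n≡m (∸-monoˡ-≤ 1 2≤L)
  from (inj₂ refl)            = trans (cong (e ⊓_) (m+n∸n≡m 1 e)) (m≥n⇒m⊓n≡n (s≤s⁻¹ 2≤L))

cyclicDist-inner≡1⇔ : ∀ {d} a b → ∣ a - b ∣ ≤ d → cyclicDist (suc (suc d)) a b ≡ 1 ⇔ ∣ a - b ∣ ≡ 1
cyclicDist-inner≡1⇔ {d} a b e≤d =
  ⇔-trans (cyclicDist≡1⇔ a b (s≤s (s≤s z≤n)) (m≤n⇒m≤1+n (m≤n⇒m≤1+n e≤d))) (mk⇔ [ id , too-long ]′ inj₁)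
  where
  too-long : suc ∣ a - b ∣ ≡ suc (suc d) → ∣ a - b ∣ ≡ 1
  too-long 1+e≡2+d = ⊥-elim (<⇒≱ (s≤s e≤d) (≤-reflexive (sym (suc-injective 1+e≡2+d))))

cyclicDist-0≡1⇔ : ∀ {d l} → l ≤ d → cyclicDist (suc (suc d)) 0 (suc l) ≡ 1 ⇔ (l ≡ 0 ⊎ l ≡ d)
cyclicDist-0≡1⇔ {d} {l} l≤d =
  ⇔-trans (cyclicDist≡1⇔ 0 (suc l) (s≤s (s≤s z≤n)) (s≤s (m≤n⇒m≤1+n l≤d)))
          (mk⇔ (map suc-injective (λ 2+l≡2+d → suc-injective (suc-injective 2+l≡2+d)))
               (map (cong suc) (cong (λ m → suc (suc m)))))

cyclicDist-offset : ∀ {L a b m} → m + m ≤ L → a + m ≡ b ⊎ a + m ≡ b + L → cyclicDist L a b ≡ m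
cyclicDist-offset {L} {a} {b} {m} m+m≤L = offset
  where
  open ≡-Reasoning
  m≤L∸m : m ≤ L ∸ m
  m≤L∸m = m+n≤o⇒m≤o∸n m m+m≤L
  m≤L : m ≤ L
  m≤L = m+n≤o⇒m≤o m m+m≤L
  offset : a + m ≡ b ⊎ a + m ≡ b + L → cyclicDist L a b ≡ m
  offset (inj₁ refl) = begin
    ∣ a - a + m ∣ ⊓ (L ∸ ∣ a - a + m ∣) ≡⟨ cong (λ e → e ⊓ (L ∸ e)) (∣m-m+n∣≡n a m) ⟩
    m ⊓ (L ∸ m)                         ≡⟨ m≤n⇒m⊓n≡m m≤L∸m ⟩
    m                                   ∎
  offset (inj₂ a+m≡b+L) = begin
    ∣ a - b ∣ ⊓ (L ∸ ∣ a - b ∣) ≡⟨ cong (λ e → e ⊓ (L ∸ e)) ∣a-b∣≡L∸m ⟩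
    (L ∸ m) ⊓ (L ∸ (L ∸ m))     ≡⟨ cong ((L ∸ m) ⊓_) (m∸[m∸n]≡n m≤L) ⟩
    (L ∸ m) ⊓ m                 ≡⟨ m≥n⇒m⊓n≡n m≤L∸m ⟩
    m                           ∎
    where
    ∣a-b∣≡L∸m : ∣ a - b ∣ ≡ L ∸ m
    ∣a-b∣≡L∸m = begin
      ∣ a - b ∣         ≡⟨ ∣m+n-m+o∣≡∣n-o∣ m a b ⟨
      ∣ m + a - m + b ∣ ≡⟨ cong₂ ∣_-_∣ (trans (+-comm m a) a+m≡b+L) (+-comm m b) ⟩
      ∣ b + L - b + m ∣ ≡⟨ ∣m+n-m+o∣≡∣n-o∣ b L m ⟩
      ∣ L - m ∣         ≡⟨ m≤n⇒∣n-m∣≡n∸m m≤L ⟩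
      L ∸ m             ∎

[m+n]%o≡[m%o+n]%o : ∀ m n o .{{_ : NonZero o}} → (m + n) % o ≡ (m % o + n) % o
[m+n]%o≡[m%o+n]%o m n o = begin
  (m + n) % o             ≡⟨ %-distribˡ-+ m n o ⟩
  (m % o + n % o) % o     ≡⟨ cong (λ r → (r + n % o) % o) (m%n%n≡m%n m o) ⟨
  (m % o % o + n % o) % o ≡⟨ %-distribˡ-+ (m % o) n o ⟨
  (m % o + n) % o         ∎
  where open ≡-Reasoning

+%-wrap : ∀ {r m L} .{{_ : NonZero L}} → r < L → m ≤ L → r + m ≡ (r + m) % L ⊎ r + m ≡ (r + m) % L + L
+%-wrap {r} {m} {L} r<L m≤L with r + m <? L
... | yes r+m<L = inj₁ (sym (m<n⇒m%n≡m r+m<L))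
... | no  r+m≮L = inj₂ (begin
  r + m               ≡⟨ m∸n+n≡m L≤r+m ⟨
  (r + m ∸ L) + L     ≡⟨ cong (_+ L) (m<n⇒m%n≡m (m<n+o⇒m∸n<o (r + m) L (+-mono-<-≤ r<L m≤L))) ⟨
  (r + m ∸ L) % L + L ≡⟨ cong (_+ L) (m≤n⇒[n∸m]%m≡n%m L≤r+m) ⟩
  (r + m) % L + L     ∎)
  where
  open ≡-Reasoning
  L≤r+m : L ≤ r + m
  L≤r+m = ≮⇒≥ r+m≮L

cyclicDist-% : ∀ {L} .{{_ : NonZero L}} n m → m + m ≤ L → cyclicDist L (n % L) ((n + m) % L) ≡ m
cyclicDist-% {L} n m m+m≤L = begin
  cyclicDist L (n % L) ((n + m) % L)     ≡⟨ cong (cyclicDist L (n % L)) ([m+n]%o≡[m%o+n]%o n m L) ⟩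
  cyclicDist L (n % L) ((n % L + m) % L) ≡⟨ cyclicDist-offset m+m≤L (+%-wrap (m%n<n n L) (m+n≤o⇒m≤o m m+m≤L)) ⟩
  m                                      ∎
  where open ≡-Reasoning

cyclicDist-shift-≤ : ∀ {L} .{{_ : NonZero L}} n {k l} → k ≤ l → (l ∸ k) + (l ∸ k) ≤ L →
                     cyclicDist L ((n + k) % L) ((n + l) % L) ≡ l ∸ k
cyclicDist-shift-≤ {L} n {k} {l} k≤l small = begin
  cyclicDist L ((n + k) % L) ((n + l) % L)
    ≡⟨ cong (λ x → cyclicDist L ((n + k) % L) (x % L)) n+l≡n+k+[l∸k] ⟩
  cyclicDist L ((n + k) % L) ((n + k + (l ∸ k)) % L) ≡⟨ cyclicDist-% (n + k) (l ∸ k) small ⟩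
  l ∸ k                                              ∎
  where
  open ≡-Reasoning
  n+l≡n+k+[l∸k] : n + l ≡ n + k + (l ∸ k)
  n+l≡n+k+[l∸k] = trans (cong (n +_) (sym (m+[n∸m]≡n k≤l))) (sym (+-assoc n k (l ∸ k)))

cyclicDist-shift : ∀ {L} .{{_ : NonZero L}} n {k l} → ∣ k - l ∣ + ∣ k - l ∣ ≤ L →
                   cyclicDist L ((n + k) % L) ((n + l) % L) ≡ ∣ k - l ∣
cyclicDist-shift {L} n {k} {l} small with ≤-total k l
... | inj₁ k≤l rewrite m≤n⇒∣m-n∣≡n∸m k≤l = cyclicDist-shift-≤ n k≤l small
... | inj₂ l≤k rewrite m≤n⇒∣n-m∣≡n∸m l≤k | cyclicDist-comm L ((n + k) % L) ((n + l) % L) =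
  cyclicDist-shift-≤ n l≤k small

cyclicDist-direction-≤ : ∀ {L a b} .{{_ : NonZero L}} → a ≤ b → a < L → b < L →
                         (a + cyclicDist L a b) % L ≡ b ⊎ (b + cyclicDist L a b) % L ≡ a
cyclicDist-direction-≤ {L} {a} {b} a≤b a<L b<L
  rewrite m≤n⇒∣m-n∣≡n∸m a≤b with ⊓-sel (b ∸ a) (L ∸ (b ∸ a))
... | inj₁ ⊓≡e   rewrite ⊓≡e   = inj₁ (trans (cong (_% L) (m+[n∸m]≡n a≤b)) (m<n⇒m%n≡m b<L))
... | inj₂ ⊓≡L∸e rewrite ⊓≡L∸e = inj₂ (begin
  (b + (L ∸ e)) % L       ≡⟨ cong (λ x → (x + (L ∸ e)) % L) (m+[n∸m]≡n a≤b) ⟨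
  (a + e + (L ∸ e)) % L   ≡⟨ cong (_% L) (+-assoc a e (L ∸ e)) ⟩
  (a + (e + (L ∸ e))) % L ≡⟨ cong (λ x → (a + x) % L) (m+[n∸m]≡n (≤-trans (m∸n≤m b a) (<⇒≤ b<L))) ⟩
  (a + L) % L             ≡⟨ [m+n]%n≡m%n a L ⟩
  a % L                   ≡⟨ m<n⇒m%n≡m a<L ⟩
  a                       ∎)
  where
  open ≡-Reasoning
  e = b ∸ a

cyclicDist-direction : ∀ {L a b} .{{_ : NonZero L}} → a < L → b < L →
                       (a + cyclicDist L a b) % L ≡ b ⊎ (b + cyclicDist L a b) % L ≡ a
cyclicDist-direction {L} {a} {b} a<L b<L with ≤-total a b
... | inj₁ a≤b = cyclicDist-direction-≤ a≤b a<L b<L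
... | inj₂ b≤a rewrite cyclicDist-comm L a b = swap (cyclicDist-direction-≤ b≤a b<L a<L)

∣[o∸m]-[o∸n]∣≡∣m-n∣ : ∀ {m n o} → m ≤ o → n ≤ o → ∣ (o ∸ m) - (o ∸ n) ∣ ≡ ∣ m - n ∣
∣[o∸m]-[o∸n]∣≡∣m-n∣ {m} {n} {o} m≤o n≤o = begin
  ∣ (o ∸ m) - (o ∸ n) ∣                 ≡⟨ ∣m+n-m+o∣≡∣n-o∣ (m + n) (o ∸ m) (o ∸ n) ⟨
  ∣ m + n + (o ∸ m) - m + n + (o ∸ n) ∣ ≡⟨ cong₂ ∣_-_∣ left right ⟩
  ∣ o + n - o + m ∣                     ≡⟨ ∣m+n-m+o∣≡∣n-o∣ o n m ⟩
  ∣ n - m ∣                             ≡⟨ ∣-∣-comm n m ⟩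
  ∣ m - n ∣                             ∎
  where
  open ≡-Reasoning
  left : m + n + (o ∸ m) ≡ o + n
  left = begin
    m + n + (o ∸ m)   ≡⟨ cong (_+ (o ∸ m)) (+-comm m n) ⟩
    n + m + (o ∸ m)   ≡⟨ +-assoc n m (o ∸ m) ⟩
    n + (m + (o ∸ m)) ≡⟨ cong (n +_) (m+[n∸m]≡n m≤o) ⟩
    n + o             ≡⟨ +-comm n o ⟩
    o + n             ∎
  right : m + n + (o ∸ n) ≡ o + m
  right = begin
    m + n + (o ∸ n)   ≡⟨ +-assoc m n (o ∸ n) ⟩
    m + (n + (o ∸ n)) ≡⟨ cong (m +_) (m+[n∸m]≡n n≤o) ⟩
    m + o             ≡⟨ +-comm m o ⟩
    o + m             ∎

-- Arcs of a cycle

∣toℕ-toℕ∣≤ : ∀ {d} (k l : Fin (suc d)) → ∣ toℕ k - toℕ l ∣ ≤ d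
∣toℕ-toℕ∣≤ k l = ≤-trans (∣m-n∣≤m⊔n (toℕ k) (toℕ l)) (⊔-lub (toℕ≤pred[n] k) (toℕ≤pred[n] l))

toℕ≡n⇒≡fromℕ : ∀ {d} {k : Fin (suc d)} → toℕ k ≡ d → k ≡ fromℕ d
toℕ≡n⇒≡fromℕ {d} k≡d = toℕ-injective (trans k≡d (sym (toℕ-fromℕ d)))

record Arc (L : ℕ) (i j : Fin L) (d : ℕ) : Set where
  field
    pos   : Fin (suc d) → Fin L
    start : pos zero ≡ i
    end   : pos (fromℕ d) ≡ j
    dist  : ∀ k l → cyclicDist L (toℕ (pos k)) (toℕ (pos l)) ≡ ∣ toℕ k - toℕ l ∣

forwardArc : ∀ {L} .{{_ : NonZero L}} (i j : Fin L) d → d + d ≤ L → (toℕ i + d) % L ≡ toℕ j → Arc L i j d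
forwardArc {L} i j d d+d≤L i+d≡j = record
  { pos   = pos
  ; start = toℕ-injective (trans (toℕ-fromℕ< _) (trans (cong (_% L) (+-identityʳ (toℕ i))) (m<n⇒m%n≡m (toℕ<n i))))
  ; end   = toℕ-injective (trans (toℕ-fromℕ< _) (trans (cong (λ e → (toℕ i + e) % L) (toℕ-fromℕ d)) i+d≡j))
  ; dist  = dist
  }
  where
  pos : Fin (suc d) → Fin L
  pos k = (toℕ i + toℕ k) mod L
  dist : ∀ k l → cyclicDist L (toℕ (pos k)) (toℕ (pos l)) ≡ ∣ toℕ k - toℕ l ∣
  dist k l rewrite toℕ-fromℕ< (m%n<n (toℕ i + toℕ k) L) | toℕ-fromℕ< (m%n<n (toℕ i + toℕ l) L) =
    cyclicDist-shift (toℕ i) (≤-trans (+-mono-≤ (∣toℕ-toℕ∣≤ k l) (∣toℕ-toℕ∣≤ k l)) d+d≤L)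

reverseArc : ∀ {L i j d} → Arc L j i d → Arc L i j d
reverseArc {L} {i} {j} {d} A = record
  { pos   = λ k → pos (opposite k)
  ; start = end
  ; end   = trans (cong pos (opposite-involutive zero)) start
  ; dist  = dist′
  }
  where
  open Arc A
  dist′ : ∀ k l → cyclicDist L (toℕ (pos (opposite k))) (toℕ (pos (opposite l))) ≡ ∣ toℕ k - toℕ l ∣
  dist′ k l rewrite dist (opposite k) (opposite l) | opposite-prop k | opposite-prop l =
    ∣[o∸m]-[o∸n]∣≡∣m-n∣ (toℕ≤pred[n] k) (toℕ≤pred[n] l)

arc : ∀ {L} (i j : Fin L) → Arc L i j (cyclicDist L (toℕ i) (toℕ j))
arc {L} i j with cyclicDist-direction {{nonZeroIndex i}} (toℕ<n i) (toℕ<n j)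
... | inj₁ i+d≡j = forwardArc {{nonZeroIndex i}} i j _ (cyclicDist-half (toℕ<n i) (toℕ<n j)) i+d≡j
... | inj₂ j+d≡i = reverseArc (forwardArc {{nonZeroIndex i}} j i _ (cyclicDist-half (toℕ<n i) (toℕ<n j)) j+d≡i)

module _ {L i j d} (A : Arc L i j d) where
  open Arc A

  pos-injective : ∀ {k l} → pos k ≡ pos l → k ≡ l
  pos-injective {k} {l} pk≡pl = toℕ-injective (∣m-n∣≡0⇒m≡n (begin
    ∣ toℕ k - toℕ l ∣                        ≡⟨ dist k l ⟨
    cyclicDist L (toℕ (pos k)) (toℕ (pos l)) ≡⟨ cong (λ t → cyclicDist L (toℕ (pos k)) (toℕ t)) pk≡pl ⟨
    cyclicDist L (toℕ (pos k)) (toℕ (pos k)) ≡⟨ cyclicDist-self L (toℕ (pos k)) ⟩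
    0                                        ∎))
    where open ≡-Reasoning

  pos-between : ∀ k → cyclicDist L (toℕ i) (toℕ (pos k)) + cyclicDist L (toℕ (pos k)) (toℕ j) ≡ d
  pos-between k = begin
    cyclicDist L (toℕ i) (toℕ (pos k)) + cyclicDist L (toℕ (pos k)) (toℕ j)
      ≡⟨ cong₂ (λ a b → cyclicDist L (toℕ a) (toℕ (pos k)) + cyclicDist L (toℕ (pos k)) (toℕ b)) start end ⟨
    cyclicDist L (toℕ (pos zero)) (toℕ (pos k)) + cyclicDist L (toℕ (pos k)) (toℕ (pos (fromℕ d)))
      ≡⟨ cong₂ _+_ (dist zero k) (dist k (fromℕ d)) ⟩
    toℕ k + ∣ toℕ k - toℕ (fromℕ d) ∣
      ≡⟨ cong (λ m → toℕ k + ∣ toℕ k - m ∣) (toℕ-fromℕ d) ⟩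
    toℕ k + ∣ toℕ k - d ∣
      ≡⟨ cong (toℕ k +_) (m≤n⇒∣m-n∣≡n∸m (toℕ≤pred[n] k)) ⟩
    toℕ k + (d ∸ toℕ k)
      ≡⟨ m+[n∸m]≡n (toℕ≤pred[n] k) ⟩
    d ∎
    where open ≡-Reasoning

-- Induced paths and holes

_∉_ : ∀ {A : Set} {m} → A → (Fin m → A) → Set
x ∉ p = ∀ k → x ≢ p k

∷-injective : ∀ {A : Set} {m y} {p : Fin m → A} → y ∉ p → (∀ {k l} → p k ≡ p l → k ≡ l) →
              ∀ {k l} → (y ∷ p) k ≡ (y ∷ p) l → k ≡ l
∷-injective y∉p p-injective {zero}  {zero}  _   = refl
∷-injective y∉p p-injective {zero}  {suc l} y≡p = ⊥-elim (y∉p l y≡p)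
∷-injective y∉p p-injective {suc k} {zero}  p≡y = ⊥-elim (y∉p k (sym p≡y))
∷-injective y∉p p-injective {suc k} {suc l} p≡p = cong suc (p-injective p≡p)

IsEnd : ∀ {d} → Fin (suc d) → Set
IsEnd {d} k = toℕ k ≡ 0 ⊎ toℕ k ≡ d

module _ (G : Graph) where
  open Graph G

  record IsInducedPath (d : ℕ) (p : Fin (suc d) → Fin n) : Set where
    field
      injective : ∀ {k l} → p k ≡ p l → k ≡ l
      adjacent⇔ : ∀ k l → Adj (p k) (p l) ⇔ ∣ toℕ k - toℕ l ∣ ≡ 1

  Adj-sym⇔ : ∀ {x y} → Adj x y ⇔ Adj y x
  Adj-sym⇔ = mk⇔ symAdj symAdj

  prepend-isInducedPath : ∀ {d p y} → IsInducedPath d p → y ∉ p → (∀ k → Adj y (p k) ⇔ toℕ k ≡ 0) →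
                          IsInducedPath (suc d) (y ∷ p)
  prepend-isInducedPath {d} {p} {y} P y∉p y-nbrs = record
    { injective = ∷-injective y∉p injective
    ; adjacent⇔ = adjacent⇔′
    }
    where
    open IsInducedPath P
    adjacent⇔′ : ∀ k l → Adj ((y ∷ p) k) ((y ∷ p) l) ⇔ ∣ toℕ k - toℕ l ∣ ≡ 1
    adjacent⇔′ zero    zero    = mk⇔ (λ y~y → ⊥-elim (irrefl y~y)) (λ ())
    adjacent⇔′ zero    (suc l) = ⇔-trans (y-nbrs l) (mk⇔ (cong suc) suc-injective)
    adjacent⇔′ (suc k) zero    = ⇔-trans Adj-sym⇔ (⇔-trans (y-nbrs k) (mk⇔ (cong suc) suc-injective))
    adjacent⇔′ (suc k) (suc l) = adjacent⇔ k l

  close-isHole : ∀ {d p y} → 2 ≤ d → IsInducedPath d p → y ∉ p → (∀ k → Adj y (p k) ⇔ IsEnd k) →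
                 IsHole G (suc (suc d)) (y ∷ p)
  close-isHole {d} {p} {y} 2≤d P y∉p y-nbrs =
    s≤s (s≤s 2≤d) , (λ k l → ∷-injective y∉p injective) ,
    λ k l → let open Equivalence (adjacent⇔′ k l) in to , from
    where
    open IsInducedPath P
    y-nbrs′ : ∀ l → Adj y (p l) ⇔ cyclicDist (suc (suc d)) 0 (suc (toℕ l)) ≡ 1
    y-nbrs′ l = ⇔-trans (y-nbrs l) (⇔-sym (cyclicDist-0≡1⇔ (toℕ≤pred[n] l)))
    adjacent⇔′ : ∀ k l → Adj ((y ∷ p) k) ((y ∷ p) l) ⇔ cyclicDist (suc (suc d)) (toℕ k) (toℕ l) ≡ 1
    adjacent⇔′ zero    zero    = mk⇔ (λ y~y → ⊥-elim (irrefl y~y)) (λ ())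
    adjacent⇔′ zero    (suc l) = y-nbrs′ l
    adjacent⇔′ (suc k) zero    = ⇔-trans Adj-sym⇔ (y-nbrs′ k)
    adjacent⇔′ (suc k) (suc l) =
      ⇔-trans (adjacent⇔ k l) (⇔-sym (cyclicDist-inner≡1⇔ (toℕ k) (toℕ l) (∣toℕ-toℕ∣≤ k l)))

  -- The trace on p of the condition x ∈ Z_(p e) ∖ Z_S, where S is the interior of p.
  Attached : ∀ {d} → (Fin (suc d) → Fin n) → Fin (suc d) → Fin n → Set
  Attached p e x = x ≡ p e ⊎ (x ∉ p × Adj x (p e) × (∀ k → Adj x (p k) → IsEnd k))

  NoHoleUpTo : ℕ → Set
  NoHoleUpTo m = ∀ L w → IsHole G L w → m < L

  ends-adjacent : ∀ {d x} {p : Fin (suc d) → Fin n} → Adj x (p zero) → Adj x (p (fromℕ d)) →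
                  ∀ k → IsEnd k → Adj x (p k)
  ends-adjacent {p = p} x~a x~b k (inj₁ k≡0) = subst (λ k → Adj _ (p k)) (sym (toℕ-injective k≡0)) x~a
  ends-adjacent {p = p} x~a x~b k (inj₂ k≡d) = subst (λ k → Adj _ (p k)) (sym (toℕ≡n⇒≡fromℕ k≡d)) x~b

  attached-nonadjacent : ∀ {d p x y} → 2 ≤ d → NoHoleUpTo (3 + d) → IsInducedPath d p →
                         Attached p zero x → Attached p (fromℕ d) y → ¬ Adj x y
  attached-nonadjacent {d} {p} {x} {y} 2≤d noHole P = edge
    where
    open IsInducedPath P
    Adj-at : ∀ {z k l} → k ≡ l → Adj z (p k) → Adj z (p l)
    Adj-at refl z~pk = z~pk
    no-short-closing : ∀ {z} → z ∉ p → Adj z (p zero) → Adj z (p (fromℕ d)) →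
                       (∀ k → Adj z (p k) → IsEnd k) → ⊥
    no-short-closing z∉p z~a z~b z-ends =
      ≤⇒≯ (n≤1+n _) (noHole _ _ (close-isHole 2≤d P z∉p (λ k → mk⇔ (z-ends k) (ends-adjacent z~a z~b k))))
    no-long-closing : x ∉ p → Adj x (p zero) → (∀ k → Adj x (p k) → IsEnd k) →
                      y ∉ p → Adj y (p (fromℕ d)) → (∀ k → Adj y (p k) → IsEnd k) →
                      Adj x y → ¬ Adj x (p (fromℕ d)) → ¬ Adj y (p zero) → ⊥
    no-long-closing x∉p x~a x-ends y∉p y~b y-ends x~y x≁b y≁a =
      ≤⇒≯ ≤-refl (noHole _ _ (close-isHole (m≤n⇒m≤1+n 2≤d) xP y∉xP y-nbrs))
      where
      x-nbrs : ∀ k → Adj x (p k) ⇔ toℕ k ≡ 0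
      x-nbrs k = mk⇔ to (λ k≡0 → Adj-at (sym (toℕ-injective k≡0)) x~a)
        where
        to : Adj x (p k) → toℕ k ≡ 0
        to x~pk = [ id , (λ k≡d → ⊥-elim (x≁b (Adj-at (toℕ≡n⇒≡fromℕ k≡d) x~pk))) ]′ (x-ends k x~pk)
      xP : IsInducedPath (suc d) (x ∷ p)
      xP = prepend-isInducedPath P x∉p x-nbrs
      y∉xP : y ∉ (x ∷ p)
      y∉xP zero    y≡x = irrefl (subst (Adj x) y≡x x~y)
      y∉xP (suc k) = y∉p k
      y-nbrs : ∀ k → Adj y ((x ∷ p) k) ⇔ IsEnd k
      y-nbrs zero    = mk⇔ (λ _ → inj₁ refl) (λ _ → symAdj x~y)
      y-nbrs (suc k) = mk⇔ to [ (λ ()) , (λ 1+k≡1+d → Adj-at (sym (toℕ≡n⇒≡fromℕ (suc-injective 1+k≡1+d))) y~b) ]′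
        where
        to : Adj y (p k) → IsEnd (suc k)
        to y~pk = [ (λ k≡0 → ⊥-elim (y≁a (Adj-at (toℕ-injective k≡0) y~pk))) , (λ k≡d → inj₂ (cong suc k≡d)) ]′
                    (y-ends k y~pk)
    edge : Attached p zero x → Attached p (fromℕ d) y → ¬ Adj x y
    edge (inj₁ refl) (inj₁ refl) a~b =
      <⇒≱ 2≤d (≤-reflexive (trans (sym (toℕ-fromℕ d)) (Equivalence.to (adjacent⇔ zero (fromℕ d)) a~b)))
    edge (inj₁ refl) (inj₂ (y∉p , y~b , y-ends)) a~y = no-short-closing y∉p (symAdj a~y) y~b y-ends
    edge (inj₂ (x∉p , x~a , x-ends)) (inj₁ refl) x~b = no-short-closing x∉p x~a x~b x-ends
    edge (inj₂ (x∉p , x~a , x-ends)) (inj₂ (y∉p , y~b , y-ends)) x~y = ¬¬-excluded-middle λ where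
      (yes x~b) → no-short-closing x∉p x~a x~b x-ends
      (no x≁b)  → ¬¬-excluded-middle λ where
        (yes y~a) → no-short-closing y∉p y~a y~b y-ends
        (no y≁a)  → no-long-closing x∉p x~a x-ends y∉p y~b y-ends x~y x≁b y≁a

-- The hole C

module _ (G : Graph) {L} (c : Fin L → Fin (Graph.n G)) where
  open Graph G
  open Cyc G c

  arc-isInducedPath : ∀ {i j d} → IsHole G L c → (A : Arc L i j d) → IsInducedPath G d (λ k → c (Arc.pos A k))
  arc-isInducedPath (_ , c-injective , c-adjacent) A = record
    { injective = λ {k} {l} c[pk]≡c[pl] → pos-injective A (c-injective (pos k) (pos l) c[pk]≡c[pl])
    ; adjacent⇔ = λ k l → let (to , from) = c-adjacent (pos k) (pos l) in
        mk⇔ (λ c~c → trans (sym (dist k l)) (to c~c)) (λ k-l≡1 → from (trans (dist k l) k-l≡1))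
    }
    where open Arc A

  arc-internal : ∀ {i j} (A : Arc L i j (distC i j)) k → ¬ IsEnd k → Internal i j (c (Arc.pos A k))
  arc-internal {i} {j} A k k∉ends =
    pos k , refl ,
    (λ pk≡i → k∉ends (inj₁ (cong toℕ (pos-injective A (trans pk≡i (sym start)))))) ,
    (λ pk≡j → k∉ends (inj₂ (trans (cong toℕ (pos-injective A (trans pk≡j (sym end)))) (toℕ-fromℕ _)))) ,
    pos-between A k
    where open Arc A

  Z∖ZS⇒attached : ∀ {i j x} (A : Arc L i j (distC i j)) e → Z (c (Arc.pos A e)) x → ¬ ZS i j x →
                  Attached G (λ k → c (Arc.pos A k)) e x
  Z∖ZS⇒attached A e (inj₁ x≡v) x∉ZS = inj₁ x≡v
  Z∖ZS⇒attached {i} {j} {x} A e (inj₂ (v~x , x∉C , x∉D)) x∉ZS = inj₂ (x∉p , symAdj v~x , only-ends)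
    where
    open Arc A
    x∉p : x ∉ (λ k → c (pos k))
    x∉p k x≡c = x∉C (pos k , sym x≡c)
    only-ends : ∀ k → Adj x (c (pos k)) → IsEnd k
    only-ends k x~c with (toℕ k ≟ 0) ⊎-dec (toℕ k ≟ distC i j)
    ... | yes k∈ends = k∈ends
    ... | no  k∉ends = ⊥-elim (x∉ZS (c (pos k) , arc-internal A k k∉ends , inj₂ (symAdj x~c , x∉C , x∉D)))

-- The threshold μ_k

-[+m]/n≤0 : ∀ m n .{{_ : NonZero n}} → (ℤ.- ℤ.+ m) ℚ./ n ℚ.≤ ℚ.0ℚ
-[+m]/n≤0 zero    n = ℚ.≤-reflexive (ℚ.0/n≡0 n)
-[+m]/n≤0 (suc m) n =
  ℚ.<⇒≤ (ℚ.negative⁻¹ _ {{ℚ.neg-pos {ℚ.normalize (suc m) n} (ℚ.normalize-pos (suc m) n)}})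

MuLt⇒threshold<L : ∀ {k L} → MuLt k L → 3217 * k + 1985 + 1216 * suc k < L
MuLt⇒threshold<L {k} {L} (0<B , _) with 3217 * k + 1985 + 1216 * suc k <? L
... | yes T<L = T<L
... | no  T≮L = ⊥-elim (ℚ.<-irrefl refl (ℚ.<-≤-trans 0<B B≤0))
  where
  T = 3217 * k + 1985 + 1216 * suc k
  B≤0 : (ℤ.+ L ℤ.- ℤ.+ T) ℚ./ (304 * suc k) ℚ.≤ ℚ.0ℚ
  B≤0 = subst (λ z → z ℚ./ (304 * suc k) ℚ.≤ ℚ.0ℚ)
              (sym (trans (ℤ.[+m]-[+n]≡m⊖n L T) (ℤ.⊖-≤ (≮⇒≥ T≮L))))
              (-[+m]/n≤0 (T ∸ L) (304 * suc k))

lemma4p4 : (G : Graph) (k : ℕ) → 1 ≤ k →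
    (L : ℕ) (c : Fin L → Fin (Graph.n G)) →
    IsShortestHole G L c → MuLt k L → Cyc.MinusChordal G c →
    (i j : Fin L) → (Cyc.distC G c i j ≡ 2 ⊎ Cyc.distC G c i j ≡ 3) →
    (x y : Fin (Graph.n G)) →
    Cyc.Z G c (c i) x → ¬ Cyc.ZS G c i j x →
    Cyc.Z G c (c j) y → ¬ Cyc.ZS G c i j y →
    ¬ Graph.Adj G x y
lemma4p4 G k _ L c (C-hole , C-shortest) μ<L _ i j d≡2⊎3 x y x∈Zi x∉ZS y∈Zj y∉ZS =
  attached-nonadjacent G 2≤d noShortHole (arc-isInducedPath G c C-hole A)
    (Z∖ZS⇒attached G c A zero (subst (λ v → Z (c v) x) (sym start) x∈Zi) x∉ZS)
    (Z∖ZS⇒attached G c A (fromℕ d) (subst (λ v → Z (c v) y) (sym end) y∈Zj) y∉ZS)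
  where
  open Cyc G c
  d = distC i j
  A = arc i j
  open Arc A
  2≤d : 2 ≤ d
  2≤d = [ (λ d≡2 → ≤-reflexive (sym d≡2)) , (λ d≡3 → ≤-trans (n≤1+n 2) (≤-reflexive (sym d≡3))) ]′
          d≡2⊎3
  d≤3 : d ≤ 3
  d≤3 = [ (λ d≡2 → ≤-trans (≤-reflexive d≡2) (n≤1+n 2)) , ≤-reflexive ]′ d≡2⊎3
  7≤L : 7 ≤ L
  7≤L = begin
    7                              ≤⟨ m≤m+n 7 1978 ⟩
    1985                           ≤⟨ m≤n+m 1985 (3217 * k) ⟩
    3217 * k + 1985                ≤⟨ m≤m+n (3217 * k + 1985) (1216 * suc k) ⟩
    3217 * k + 1985 + 1216 * suc k <⟨ MuLt⇒threshold<L μ<L ⟩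
    L                              ∎
    where open ≤-Reasoning
  noShortHole : NoHoleUpTo G (3 + d)
  noShortHole L′ w w-hole = ≤-trans (s≤s (+-monoʳ-≤ 3 d≤3)) (≤-trans 7≤L (C-shortest L′ w w-hole))
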